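{- For $\heartsuit\in\{B,C,D,BC\}$ and $u,v\in\mathbb{Z}^n$: if $(x^v,x^u)^\heartsuit\ne0$ then $v\le-u$. For $u,v\in\mathbb{N}^n$: if $(x^v,x^u)^A\neq0$ then $v\le u\omega$ and $|v|=|u|$, where $u\omega=[u_n,\dots,u_1]$ and $|v|=v_1+\dots+v_n$.
   Context: $x^v=\prod x_i^{v_i}$. Order on $\mathbb{Z}^n$: $u\le v$ iff $u_1+\dots+u_k\le v_1+\dots+v_k$ for all $k$. With $\beta$ a parameter, $\rho^B=[n-\tfrac12,\dots,\tfrac12]$, $\rho^C=\rho^{BC}=[n,\dots,1]$, $\rho^D=[n-1,\dots,0]$, $\Delta^B=\prod_i(x_i^{1/2}-x_i^{ -1/2})\prod_{i<j}(x_i-x_j)(1-\frac1{x_ix_j})$, $\Delta^C=\prod_i(x_i-x_i^{ -1})\prod_{i<j}(x_i-x_j)(1-\frac1{x_ix_j})$, $\Delta^D=\prod_{i<j}(x_i-x_j)(1-\frac1{x_ix_j})$, $\Delta^{BC}=\Delta^C\prod_i(1+\beta x_i)^{ -1}$ (expanded as formal power series in $\beta x_i$): $(f,g)^\heartsuit=\mathrm{CT}(fg\,x^{\rho^\heartsuit}\Delta^\heartsuit)$ and $(f,g)^A=\mathrm{CT}\big(f(x_1,\dots,x_n)g(x_n^{ -1},\dots,x_1^{ -1})\prod_{i<j}(1-x_i/x_j)\big)$, CT being the constant term in $x_1,\dots,x_n$. -}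

module Defs where

open import Data.Nat as ℕ using (ℕ; zero; suc; _∸_)
open import Data.Integer as ℤ using (ℤ; +_; -_; _+_; _*_; _≤_)
open import Data.Fin as Fin using (Fin; toℕ)
open import Data.Vec as Vec using (Vec; []; _∷_)
import Data.Vec.Properties as VecP
open import Data.List as List using (List; []; _∷_; _++_; concatMap; foldr)
open import Data.Product using (_×_; _,_)
open import Data.Bool using (if_then_else_)
open import Relation.Nullary using (¬_)
open import Relation.Nullary.Decidable using (does)
open import Relation.Binary.PropositionalEquality using (_≡_; _≢_)

-- Laurent polynomials in x₁,…,xₙ with *half-integer* exponents
-- (needed for type B, where x_i^{1/2} and ρ^B ∈ (½ℤ)ⁿ occur).
-- A polynomial is a formal finite sum Σ c · x^{e/2}, stored as a list of
-- pairs (c , e) with c ∈ ℤ and e ∈ ℤⁿ the DOUBLED exponent vector.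
-- Only the constant term is ever inspected, and it is well defined on
-- formal sums (it just adds up the coefficients with exponent 0).

Laurent : ℕ → Set
Laurent n = List (ℤ × Vec ℤ n)

Xhalf : ∀ {n} → Vec ℤ n → Laurent n
Xhalf e = (+ 1 , e) ∷ []

X : ∀ {n} → Vec ℤ n → Laurent n
X e = Xhalf (Vec.map (λ a → a + a) e)

one : ∀ {n} → Laurent n
one = Xhalf (Vec.replicate _ (+ 0))

_⊕_ : ∀ {n} → Laurent n → Laurent n → Laurent n
p ⊕ q = p ++ q

scale : ∀ {n} → ℤ → Laurent n → Laurent n
scale c = List.map (λ { (d , e) → (c * d , e) })

_⊖_ : ∀ {n} → Laurent n → Laurent n → Laurent n
p ⊖ q = p ++ scale (- + 1) q

_⊗_ : ∀ {n} → Laurent n → Laurent n → Laurent n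
p ⊗ q = concatMap (λ { (c , e) → List.map (λ { (d , f) → (c * d , Vec.zipWith _+_ e f) }) q }) p

infixr 7 _⊗_
infixl 6 _⊕_ _⊖_

prodL : ∀ {n} → List (Laurent n) → Laurent n
prodL = foldr _⊗_ one

sumL : ∀ {n} → List (Laurent n) → Laurent n
sumL = foldr _⊕_ []

CT : ∀ {n} → Laurent n → ℤ
CT [] = + 0
CT ((c , e) ∷ p) =
  if does (VecP.≡-dec ℤ._≟_ e (Vec.replicate _ (+ 0))) then c + CT p else CT p

unit : ∀ {n} → Fin n → ℤ → Vec ℤ n
unit i a = Vec.tabulate (λ j → if does (i Fin.≟ j) then a else + 0)

xi^ : ∀ {n} → Fin n → ℤ → Laurent n
xi^ i a = X (unit i a)

xi^half : ∀ {n} → Fin n → ℤ → Laurent n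
xi^half i a = Xhalf (unit i a)

indices : ∀ n → List (Fin n)
indices n = List.allFin n

pairs : ∀ n → List (Fin n × Fin n)
pairs n = concatMap (λ i → concatMap (λ j → if does (i Fin.<? j) then (i , j) ∷ [] else [])
                                     (indices n)) (indices n)

-- Weyl denominators and ρ vectors   (positions are 0-based here: i = 0…n-1
-- corresponds to the paper's index i+1)

ΔD : ∀ n → Laurent n
ΔD n = prodL (List.map (λ { (i , j) →
          (xi^ i (+ 1) ⊖ xi^ j (+ 1))
          ⊗ (one ⊖ X (Vec.zipWith _+_ (unit i (- + 1)) (unit j (- + 1)))) })
        (pairs n))

ΔC : ∀ n → Laurent n
ΔC n = prodL (List.map (λ i → xi^ i (+ 1) ⊖ xi^ i (- + 1)) (indices n)) ⊗ ΔD n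

ΔB : ∀ n → Laurent n
ΔB n = prodL (List.map (λ i → xi^half i (+ 1) ⊖ xi^half i (- + 1)) (indices n)) ⊗ ΔD n

-- x^{ρ^B},  ρ^B = [n-1/2, …, 1/2]  (doubled: 2n-1, …, 1)
xρB : ∀ n → Laurent n
xρB n = Xhalf (Vec.tabulate (λ i → + ((n ℕ.+ n) ∸ suc (toℕ i ℕ.+ toℕ i))))

-- ρ^C = ρ^{BC} = [n, …, 1]
ρC : ∀ n → Vec ℤ n
ρC n = Vec.tabulate (λ i → + (n ∸ toℕ i))

ρD : ∀ n → Vec ℤ n
ρD n = Vec.tabulate (λ i → + (n ∸ suc (toℕ i)))

comps : ∀ n → ℕ → List (Vec ℕ n)
comps zero zero = [] ∷ []
comps zero (suc k) = []
comps (suc n) k = concatMap (λ m → List.map (m ∷_) (comps n (k ∸ m))) (List.upTo (suc k))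

-- coefficient of β^k in ∏_i (1 + β x_i)^{-1} = ∏_i Σ_m (-β x_i)^m :
--   Σ_{m ∈ ℕⁿ, |m| = k} (-1)^k x^m
geomCoeff : ∀ n → ℕ → Laurent n
geomCoeff n k = scale (sign k) (sumL (List.map (λ m → X (Vec.map (λ a → + a) m)) (comps n k)))
  where
  sign : ℕ → ℤ
  sign zero = + 1
  sign (suc j) = - sign j

pairB : ∀ {n} → Laurent n → Laurent n → ℤ
pairB {n} f g = CT (f ⊗ g ⊗ xρB n ⊗ ΔB n)

pairC : ∀ {n} → Laurent n → Laurent n → ℤ
pairC {n} f g = CT (f ⊗ g ⊗ X (ρC n) ⊗ ΔC n)

pairD : ∀ {n} → Laurent n → Laurent n → ℤ
pairD {n} f g = CT (f ⊗ g ⊗ X (ρD n) ⊗ ΔD n)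

-- (f,g)^{BC} is a formal power series in β; this is its β^k coefficient
pairBC : ∀ {n} → Laurent n → Laurent n → ℕ → ℤ
pairBC {n} f g k = CT (f ⊗ g ⊗ X (ρC n) ⊗ ΔC n ⊗ geomCoeff n k)

pairAmon : ∀ {n} → Vec ℕ n → Vec ℕ n → ℤ
pairAmon {n} v u =
  CT (X (Vec.map (λ a → + a) v) ⊗ X (Vec.map (λ a → - (+ a)) (Vec.reverse u))
      ⊗ prodL (List.map (λ { (i , j) →
              one ⊖ X (Vec.zipWith _+_ (unit i (+ 1)) (unit j (- + 1))) }) (pairs n)))

data Heart : Set where
  B C D BC : Heart

PairingNonzero : Heart → ∀ {n} → Vec ℤ n → Vec ℤ n → Set
PairingNonzero B v u = pairB (X v) (X u) ≢ + 0
PairingNonzero C v u = pairC (X v) (X u) ≢ + 0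
PairingNonzero D v u = pairD (X v) (X u) ≢ + 0
PairingNonzero BC v u = ¬ (∀ k → pairBC (X v) (X u) k ≡ + 0)

psum : ∀ {n} → ℕ → Vec ℤ n → ℤ
psum k v = List.foldr _+_ (+ 0) (List.take k (Vec.toList v))

_≼_ : ∀ {n} → Vec ℤ n → Vec ℤ n → Set
u ≼ v = ∀ k → k ℕ.≤ Vec.length u → psum k u ≤ psum k v

negV : ∀ {n} → Vec ℤ n → Vec ℤ n
negV = Vec.map -_

toZ : ∀ {n} → Vec ℕ n → Vec ℤ n
toZ = Vec.map (λ a → + a)

∣_∣ₙ : ∀ {n} → Vec ℕ n → ℕ
∣ v ∣ₙ = Vec.sum v

{-# OPTIONS --safe #-}
module Submission where

-- Every monomial x^e of x^ρ Δ (for BC: of x^ρ Δ^C times any β-coefficient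
-- of ∏ (1 + β x_i)⁻¹) has all partial sums e₁ + ⋯ + e_k ≥ 0. Indeed, in the
-- k-th partial sum each factor (x_i - x_j)(1 - x_i⁻¹x_j⁻¹) with i < j, and
-- each x_i - x_i⁻¹, loses at most [i ≤ k], each x_i^½ - x_i^-½ at most
-- ½[i ≤ k], and these losses add up to exactly ρ₁ + ⋯ + ρ_k. A nonzero
-- constant term of x^v x^u x^ρ Δ thus comes from a monomial with
-- v + u + e = 0, whence v ≤ -u. Type A is the same argument for the factors
-- 1 - x_i/x_j, which lose nothing; as they are homogeneous of degree 0, the
-- n-th partial sum is also bounded from the other side, giving |v| = |u|.

open import Defs
open import Data.Bool.Base using (true; false; if_then_else_)
open import Data.Empty using (⊥-elim)
open import Data.Fin.Base as Fin using (Fin; toℕ)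
import Data.Fin.Properties as Finₚ
open import Data.Integer.Base as ℤ using (ℤ; +_; -_; _+_; _≤_)
import Data.Integer.Properties as ℤₚ
open import Data.Integer.Tactic.RingSolver using (solve-∀)
open import Data.List.Base as List using (List; []; _∷_; _++_)
import Data.List.Properties as Listₚ
open import Data.List.Relation.Binary.Permutation.Propositional.Properties using (↭-reverse)
open import Data.List.Relation.Unary.All as All using (All; []; _∷_)
import Data.List.Relation.Unary.All.Properties as Allₚ
open import Data.Nat.Base as ℕ using (ℕ; zero; suc; _∸_)
import Data.Nat.Properties as ℕₚ
import Data.Nat.Tactic.RingSolver as ℕ-Solver
open import Data.Nat.ListAction using (sum)
open import Data.Nat.ListAction.Properties using (sum-++; sum-↭)
open import Data.Product.Base using (_×_; _,_; proj₁; proj₂)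
open import Data.Vec.Base as Vec using (Vec; []; _∷_; reverse)
import Data.Vec.Properties as Vecₚ
open import Function.Base using (_∘_)
open import Relation.Binary.PropositionalEquality
open import Relation.Nullary.Decidable using (yes; no; does; decidable-stable)

open import Algebra.Properties.AbelianGroup ℤₚ.+-0-abelianGroup using (identityʳ-unique)
open import Algebra.Properties.CommutativeSemigroup ℤₚ.+-commutativeSemigroup
  using () renaming (interchange to +-interchange)
open import Algebra.Properties.Semiring.Sum ℕₚ.+-*-semiring
  using (sum-syntax; ∑-distrib-+; *-distribˡ-sum; sum-cong-≗; sum-replicate-zero)

Exponents : ∀ {n} → (Vec ℤ n → Set) → Laurent n → Set
Exponents P = All (P ∘ proj₂)

module _ {n : ℕ} {P : Vec ℤ n → Set} where

  exponents-Xhalf : ∀ {e} → P e → Exponents P (Xhalf e)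
  exponents-Xhalf pe = pe ∷ []

  exponents-⊖ : ∀ {p q} → Exponents P p → Exponents P q → Exponents P (p ⊖ q)
  exponents-⊖ ps qs = Allₚ.++⁺ ps (Allₚ.map⁺ qs)

  exponents-sumL : ∀ {ps} → All (Exponents P) ps → Exponents P (sumL ps)
  exponents-sumL []       = []
  exponents-sumL (p ∷ ps) = Allₚ.++⁺ p (exponents-sumL ps)

  exponents-⊗ : ∀ {Q R : Vec ℤ n → Set} → (∀ {e f} → P e → Q f → R (Vec.zipWith _+_ e f)) →
                ∀ {p q} → Exponents P p → Exponents Q q → Exponents R (p ⊗ q)
  exponents-⊗ _ []        _  = []
  exponents-⊗ h (pe ∷ ps) qs = Allₚ.++⁺ (Allₚ.map⁺ (All.map (h pe) qs)) (exponents-⊗ h ps qs)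

  CT≢0⇒zero-exponent : ∀ {p} → Exponents P p → CT p ≢ + 0 → P (Vec.replicate n (+ 0))
  CT≢0⇒zero-exponent {[]}          []        CT≢0 = ⊥-elim (CT≢0 refl)
  CT≢0⇒zero-exponent {(c , e) ∷ p} (pe ∷ ps) CT≢0
    with Vecₚ.≡-dec ℤₚ._≟_ e (Vec.replicate n (+ 0))
  ... | yes refl = pe
  ... | no _     = CT≢0⇒zero-exponent ps CT≢0

-- Lower bounds for additive functionals of the exponents

IsAdditive : ∀ {n} → (Vec ℤ n → ℤ) → Set
IsAdditive φ = ∀ e f → φ (Vec.zipWith _+_ e f) ≡ φ e + φ f

infix 4 _≤[_]_
_≤[_]_ : ∀ {n} → ℤ → (Vec ℤ n → ℤ) → Laurent n → Set
b ≤[ φ ] p = Exponents (λ e → b ≤ φ e) p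

neg-pos-+ : ∀ m n → - + (m ℕ.+ n) ≡ - + m + - + n
neg-pos-+ m n = trans (cong -_ (ℤₚ.pos-+ m n)) (ℤₚ.neg-distrib-+ (+ m) (+ n))

i+i≤0⇒i≤0 : ∀ {i} → i + i ≤ + 0 → i ≤ + 0
i+i≤0⇒i≤0 {+ zero}    _           = ℤₚ.≤-refl
i+i≤0⇒i≤0 {ℤ.+[1+ _ ]} (ℤ.+≤+ ())
i+i≤0⇒i≤0 {ℤ.-[1+ _ ]} _           = ℤ.-≤+

i+j≤0⇒i≤-j : ∀ {i j} → i + j ≤ + 0 → i ≤ - j
i+j≤0⇒i≤-j {i} {j} i+j≤0 =
  ℤₚ.i-j≤0⇒i≤j (subst (λ x → i + x ≤ + 0) (sym (ℤₚ.neg-involutive j)) i+j≤0)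

map-double : ∀ {n} (e : Vec ℤ n) → Vec.map (λ a → a + a) e ≡ Vec.zipWith _+_ e e
map-double []      = refl
map-double (a ∷ e) = cong (a + a ∷_) (map-double e)

module LowerBound {n : ℕ} (φ : Vec ℤ n → ℤ) (φ-additive : IsAdditive φ) where

  φ-zero : φ (Vec.replicate n (+ 0)) ≡ + 0
  φ-zero = identityʳ-unique (φ 0ⁿ) (φ 0ⁿ)
    (trans (sym (φ-additive 0ⁿ 0ⁿ)) (cong φ (Vecₚ.zipWith-replicate _+_ (+ 0) (+ 0))))
    where 0ⁿ = Vec.replicate n (+ 0)

  φ-double : ∀ e → φ (Vec.map (λ a → a + a) e) ≡ φ e + φ e
  φ-double e = trans (cong φ (map-double e)) (φ-additive e e)

  φ-double-+ : ∀ e f → φ (Vec.map (λ a → a + a) (Vec.zipWith _+_ e f)) ≡ (φ e + φ f) + (φ e + φ f)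
  φ-double-+ e f = trans (φ-double _) (cong₂ _+_ (φ-additive e f) (φ-additive e f))

  bound-weaken : ∀ {a b p} → a ≤ b → b ≤[ φ ] p → a ≤[ φ ] p
  bound-weaken a≤b = All.map (ℤₚ.≤-trans a≤b)

  bound-⊗ : ∀ {a b p q} → a ≤[ φ ] p → b ≤[ φ ] q → a + b ≤[ φ ] p ⊗ q
  bound-⊗ {a} {b} = exponents-⊗ λ {e} {f} a≤φe b≤φf →
    subst (a + b ≤_) (sym (φ-additive e f)) (ℤₚ.+-mono-≤ a≤φe b≤φf)

  bound-one : + 0 ≤[ φ ] one
  bound-one = exponents-Xhalf (ℤₚ.≤-reflexive (sym φ-zero))

  nonneg-prodL : ∀ {ps} → All (+ 0 ≤[ φ ]_) ps → + 0 ≤[ φ ] prodL ps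
  nonneg-prodL []       = bound-one
  nonneg-prodL (p ∷ ps) = bound-⊗ p (nonneg-prodL ps)

  bound-prodL : ∀ {A : Set} (F : A → Laurent n) (d : A → ℕ) {xs} →
                All (λ x → - + d x ≤[ φ ] F x) xs →
                - + sum (List.map d xs) ≤[ φ ] prodL (List.map F xs)
  bound-prodL F d []                = bound-one
  bound-prodL F d {x ∷ xs} (h ∷ hs) =
    bound-weaken (ℤₚ.≤-reflexive (neg-pos-+ (d x) _)) (bound-⊗ h (bound-prodL F d hs))

  bound-shift : ∀ {d e p} → + d ≤ φ e → - + d ≤[ φ ] p → + 0 ≤[ φ ] Xhalf e ⊗ p
  bound-shift {d} d≤φe h =
    bound-weaken (ℤₚ.≤-reflexive (sym (ℤₚ.+-inverseʳ (+ d)))) (bound-⊗ (exponents-Xhalf d≤φe) h)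

  -- Exponents are stored doubled: the zero exponent of x^v x^u R is 2v + 2u + e
  -- for an exponent e of R, and halving φ (2v + 2u) ≤ 0 gives the claim.
  pairing-bound : ∀ {v u R} → + 0 ≤[ φ ] R → CT (X v ⊗ X u ⊗ R) ≢ + 0 → φ v ≤ - φ u
  pairing-bound {v} {u} {R} R≥0 CT≢0 = i+j≤0⇒i≤-j (i+i≤0⇒i≤0 (begin
    (φ v + φ u) + (φ v + φ u)                ≡⟨ +-interchange (φ v) (φ u) (φ v) (φ u) ⟩
    (φ v + φ v) + (φ u + φ u)                ≡⟨ cong₂ _+_ (sym (φ-double v))
                                                  (sym (trans (ℤₚ.+-identityʳ _) (φ-double u))) ⟩
    φ 2v + (φ 2u + + 0)                      ≤⟨ CT≢0⇒zero-exponent bound CT≢0 ⟩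
    φ (Vec.replicate n (+ 0))                ≡⟨ φ-zero ⟩
    + 0                                      ∎))
    where
    open ℤₚ.≤-Reasoning
    2v 2u : Vec ℤ n
    2v = Vec.map (λ a → a + a) v
    2u = Vec.map (λ a → a + a) u
    bound : φ 2v + (φ 2u + + 0) ≤[ φ ] X v ⊗ X u ⊗ R
    bound = bound-⊗ (exponents-Xhalf ℤₚ.≤-refl) (bound-⊗ (exponents-Xhalf ℤₚ.≤-refl) R≥0)

psum-additive : ∀ {n} k → IsAdditive (psum {n} k)
psum-additive zero    e       f       = refl
psum-additive (suc k) []      []      = refl
psum-additive (suc k) (a ∷ e) (b ∷ f) =
  trans (cong (_+_ (a + b)) (psum-additive k e f)) (+-interchange a b (psum k e) (psum k f))

neg-psum-additive : ∀ {n} k → IsAdditive (λ e → - psum {n} k e)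
neg-psum-additive k e f = trans (cong -_ (psum-additive k e f)) (ℤₚ.neg-distrib-+ (psum k e) (psum k f))

psum-negV : ∀ {n} k (v : Vec ℤ n) → psum k (negV v) ≡ - psum k v
psum-negV zero    v       = refl
psum-negV (suc k) []      = refl
psum-negV (suc k) (a ∷ v) =
  trans (cong (_+_ (- a)) (psum-negV k v)) (sym (ℤₚ.neg-distrib-+ a (psum k v)))

psum-toZ-nonneg : ∀ {n} k (m : Vec ℕ n) → + 0 ≤ psum k (toZ m)
psum-toZ-nonneg zero    m       = ℤₚ.≤-refl
psum-toZ-nonneg (suc k) []      = ℤₚ.≤-refl
psum-toZ-nonneg (suc k) (a ∷ m) = ℤₚ.+-mono-≤ (ℤ.+≤+ ℕ.z≤n) (psum-toZ-nonneg k m)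

psum-toZ-length : ∀ {n} (m : Vec ℕ n) → psum n (toZ m) ≡ + Vec.sum m
psum-toZ-length []      = refl
psum-toZ-length (a ∷ m) = trans (cong (_+_ (+ a)) (psum-toZ-length m)) (sym (ℤₚ.pos-+ a _))

𝟙[_<_] : ℕ → ℕ → ℕ
𝟙[ m < k ] = if m ℕ.<ᵇ k then 1 else 0

𝟙-antitone : ∀ {m m'} k → m ℕ.< m' → 𝟙[ m' < k ] ℕ.≤ 𝟙[ m < k ]
𝟙-antitone                  zero    _               = ℕ.z≤n
𝟙-antitone {zero}  {suc m'} (suc k) _               = 𝟙≤1 m' k
  where
  𝟙≤1 : ∀ m k → 𝟙[ m < k ] ℕ.≤ 1
  𝟙≤1 _       zero    = ℕ.z≤n
  𝟙≤1 zero    (suc k) = ℕₚ.≤-refl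
  𝟙≤1 (suc m) (suc k) = 𝟙≤1 m k
𝟙-antitone {suc m} {suc m'} (suc k) (ℕ.s≤s m<m') = 𝟙-antitone k m<m'

𝟙-toℕ< : ∀ {n} (i : Fin n) → 𝟙[ toℕ i < n ] ≡ 1
𝟙-toℕ< Fin.zero    = refl
𝟙-toℕ< (Fin.suc i) = 𝟙-toℕ< i

psum-zeros : ∀ {n} k → psum k (Vec.tabulate {n = n} (λ _ → + 0)) ≡ + 0
psum-zeros         zero    = refl
psum-zeros {zero}  (suc k) = refl
psum-zeros {suc n} (suc k) = trans (ℤₚ.+-identityˡ _) (psum-zeros {n} k)

psum-unit : ∀ {n} k (i : Fin n) a → psum k (unit i a) ≡ + 𝟙[ toℕ i < k ] ℤ.* a
psum-unit zero    i           a = refl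
psum-unit (suc k) Fin.zero    a =
  trans (cong (_+_ a) (psum-zeros k)) (trans (ℤₚ.+-identityʳ a) (sym (ℤₚ.*-identityˡ a)))
psum-unit (suc k) (Fin.suc i) a = trans (ℤₚ.+-identityˡ _) (psum-unit k i a)

psum-unit⁺ : ∀ {n} k (i : Fin n) → psum k (unit i (+ 1)) ≡ + 𝟙[ toℕ i < k ]
psum-unit⁺ k i = trans (psum-unit k i (+ 1)) (ℤₚ.*-identityʳ _)

psum-unit⁻ : ∀ {n} k (i : Fin n) → psum k (unit i (- + 1)) ≡ - + 𝟙[ toℕ i < k ]
psum-unit⁻ k i = trans (psum-unit k i (- + 1))
  (trans (sym (ℤₚ.neg-distribʳ-* (+ 𝟙[ toℕ i < k ]) (+ 1))) (cong -_ (ℤₚ.*-identityʳ _)))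

psum-tabulate : ∀ {n} k (f : Fin n → ℕ) →
                psum k (Vec.tabulate (λ i → + f i)) ≡ + ∑[ i < n ] (𝟙[ toℕ i < k ] ℕ.* f i)
psum-tabulate {n}     zero    f = sym (cong +_ (sum-replicate-zero n))
psum-tabulate {zero}  (suc k) f = refl
psum-tabulate {suc n} (suc k) f =
  trans (cong (_+_ (+ f Fin.zero)) (psum-tabulate k (f ∘ Fin.suc)))
        (trans (sym (ℤₚ.pos-+ (f Fin.zero) _))
               (cong (λ x → + (x ℕ.+ rest)) (sym (ℕₚ.*-identityˡ (f Fin.zero)))))
  where rest = ∑[ i < n ] (𝟙[ toℕ i < k ] ℕ.* f (Fin.suc i))

sum-tabulate : ∀ {n} (g : Fin n → ℕ) → sum (List.tabulate g) ≡ ∑[ i < n ] g i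
sum-tabulate {zero}  g = refl
sum-tabulate {suc n} g = cong (g Fin.zero ℕ.+_) (sum-tabulate (g ∘ Fin.suc))

sum-map-indices : ∀ n (g : Fin n → ℕ) → sum (List.map g (indices n)) ≡ ∑[ i < n ] g i
sum-map-indices n g = trans (cong sum (Listₚ.map-tabulate (λ i → i) g)) (sum-tabulate g)

sum-map-concatMap : ∀ {A B : Set} (h : B → ℕ) (G : A → List B) xs →
                    sum (List.map h (List.concatMap G xs)) ≡ sum (List.map (sum ∘ List.map h ∘ G) xs)
sum-map-concatMap h G []       = refl
sum-map-concatMap h G (x ∷ xs) = begin
  sum (List.map h (G x ++ List.concatMap G xs))
    ≡⟨ cong sum (Listₚ.map-++ h (G x) _) ⟩
  sum (List.map h (G x) ++ List.map h (List.concatMap G xs))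
    ≡⟨ sum-++ (List.map h (G x)) _ ⟩
  sum (List.map h (G x)) ℕ.+ sum (List.map h (List.concatMap G xs))
    ≡⟨ cong (sum (List.map h (G x)) ℕ.+_) (sum-map-concatMap h G xs) ⟩
  sum (List.map (sum ∘ List.map h ∘ G) (x ∷ xs)) ∎
  where open ≡-Reasoning

sum-map-if : ∀ {A : Set} (h : A → ℕ) b x →
             sum (List.map h (if b then x ∷ [] else [])) ≡ h x ℕ.* (if b then 1 else 0)
sum-map-if h true  x = trans (ℕₚ.+-identityʳ (h x)) (sym (ℕₚ.*-identityʳ (h x)))
sum-map-if h false x = sym (ℕₚ.*-zeroʳ (h x))

∑-𝟙< : ∀ n m → ∑[ j < n ] 𝟙[ m < toℕ j ] ≡ n ∸ suc m
∑-𝟙< zero    m       = refl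
∑-𝟙< (suc n) zero    = ∑-1 n
  where
  ∑-1 : ∀ n → ∑[ j < n ] 1 ≡ n
  ∑-1 zero    = refl
  ∑-1 (suc n) = cong suc (∑-1 n)
∑-𝟙< (suc n) (suc m) = ∑-𝟙< n m

pairs-cell : ∀ {n} → Fin n → Fin n → List (Fin n × Fin n)
pairs-cell i j = if does (i Finₚ.<? j) then (i , j) ∷ [] else []

sum-map-pairs : ∀ n (g : Fin n → ℕ) →
                sum (List.map (g ∘ proj₁) (pairs n)) ≡ ∑[ i < n ] (g i ℕ.* (n ∸ suc (toℕ i)))
sum-map-pairs n g = begin
  sum (List.map (g ∘ proj₁) (pairs n))
    ≡⟨ sum-map-concatMap (g ∘ proj₁) row (indices n) ⟩
  sum (List.map (sum ∘ List.map (g ∘ proj₁) ∘ row) (indices n))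
    ≡⟨ sum-map-indices n _ ⟩
  ∑[ i < n ] sum (List.map (g ∘ proj₁) (row i))
    ≡⟨ sum-cong-≗ {n = n} row-sum ⟩
  ∑[ i < n ] (g i ℕ.* (n ∸ suc (toℕ i))) ∎
  where
  open ≡-Reasoning
  row : Fin n → List (Fin n × Fin n)
  row i = List.concatMap (pairs-cell i) (indices n)
  row-sum : ∀ i → sum (List.map (g ∘ proj₁) (row i)) ≡ g i ℕ.* (n ∸ suc (toℕ i))
  row-sum i = begin
    sum (List.map (g ∘ proj₁) (row i))
      ≡⟨ sum-map-concatMap (g ∘ proj₁) (pairs-cell i) (indices n) ⟩
    sum (List.map (sum ∘ List.map (g ∘ proj₁) ∘ pairs-cell i) (indices n))
      ≡⟨ sum-map-indices n _ ⟩
    ∑[ j < n ] sum (List.map (g ∘ proj₁) (pairs-cell i j))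
      ≡⟨ sum-cong-≗ {n = n} (λ j → sum-map-if (g ∘ proj₁) (does (i Finₚ.<? j)) (i , j)) ⟩
    ∑[ j < n ] (g i ℕ.* 𝟙[ toℕ i < toℕ j ])
      ≡⟨ *-distribˡ-sum {n = n} (g i) (λ j → 𝟙[ toℕ i < toℕ j ]) ⟨
    g i ℕ.* ∑[ j < n ] 𝟙[ toℕ i < toℕ j ]
      ≡⟨ cong (g i ℕ.*_) (∑-𝟙< n (toℕ i)) ⟩
    g i ℕ.* (n ∸ suc (toℕ i)) ∎

Ordered : ∀ {n} → Fin n × Fin n → Set
Ordered (i , j) = i Fin.< j

pairs-ordered : ∀ n → All Ordered (pairs n)
pairs-ordered n = Allₚ.concat⁺ (Allₚ.map⁺ (All.universal (λ i →
  Allₚ.concat⁺ (Allₚ.map⁺ (All.universal (ordered i) (indices n)))) (indices n)))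
  where
  ordered : ∀ i j → All Ordered (pairs-cell i j)
  ordered i j with toℕ i ℕ.<ᵇ toℕ j | ℕₚ.<ᵇ⇒< (toℕ i) (toℕ j)
  ... | true  | i<j = i<j _ ∷ []
  ... | false | _   = []

-- Partial sums of the exponents of the Weyl denominators

∸-toℕ : ∀ {n} (i : Fin n) → n ∸ toℕ i ≡ suc (n ∸ suc (toℕ i))
∸-toℕ i = ℕₚ.+-∸-assoc 1 (Finₚ.toℕ<n i)

double-∸-toℕ : ∀ {n} (i : Fin n) →
               (n ℕ.+ n) ∸ suc (toℕ i ℕ.+ toℕ i) ≡ suc ((n ∸ suc (toℕ i)) ℕ.+ (n ∸ suc (toℕ i)))
double-∸-toℕ {suc n} Fin.zero    = ℕₚ.+-suc n n
double-∸-toℕ {suc n} (Fin.suc i)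
  rewrite ℕₚ.+-suc n n | ℕₚ.+-suc (toℕ i) (toℕ i) = double-∸-toℕ i

D-factor : ∀ {n} → Fin n × Fin n → Laurent n
D-factor (i , j) =
  (xi^ i (+ 1) ⊖ xi^ j (+ 1)) ⊗ (one ⊖ X (Vec.zipWith _+_ (unit i (- + 1)) (unit j (- + 1))))

A-factor : ∀ {n} → Fin n × Fin n → Laurent n
A-factor (i , j) = one ⊖ X (Vec.zipWith _+_ (unit i (+ 1)) (unit j (- + 1)))

-- Bounds are on doubled exponents, so every deficit is twice the paper's.
module PartialSumBounds {n : ℕ} (k : ℕ) where
  open LowerBound (psum {n} k) (psum-additive k)

  𝟙ₖ : Fin n → ℕ
  𝟙ₖ i = 𝟙[ toℕ i < k ]

  psum-2eᵢ⁺ : ∀ i → psum k (Vec.map (λ a → a + a) (unit i (+ 1))) ≡ + 𝟙ₖ i + + 𝟙ₖ i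
  psum-2eᵢ⁺ i = trans (φ-double _) (cong₂ _+_ (psum-unit⁺ k i) (psum-unit⁺ k i))

  psum-2eᵢ⁻ : ∀ i → psum k (Vec.map (λ a → a + a) (unit i (- + 1))) ≡ - + 𝟙ₖ i + - + 𝟙ₖ i
  psum-2eᵢ⁻ i = trans (φ-double _) (cong₂ _+_ (psum-unit⁻ k i) (psum-unit⁻ k i))

  B-factor-bound : ∀ i → - + 𝟙ₖ i ≤[ psum k ] xi^half i (+ 1) ⊖ xi^half i (- + 1)
  B-factor-bound i = exponents-⊖
    (exponents-Xhalf (subst (- + 𝟙ₖ i ≤_) (sym (psum-unit⁺ k i)) ℤₚ.neg-≤-pos))
    (exponents-Xhalf (ℤₚ.≤-reflexive (sym (psum-unit⁻ k i))))

  C-factor-bound : ∀ i → - + (𝟙ₖ i ℕ.+ 𝟙ₖ i) ≤[ psum k ] xi^ i (+ 1) ⊖ xi^ i (- + 1)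
  C-factor-bound i = exponents-⊖
    (exponents-Xhalf (subst (- + (𝟙ₖ i ℕ.+ 𝟙ₖ i) ≤_) (sym (psum-2eᵢ⁺ i)) ℤₚ.neg-≤-pos))
    (exponents-Xhalf (ℤₚ.≤-reflexive (trans (neg-pos-+ (𝟙ₖ i) (𝟙ₖ i)) (sym (psum-2eᵢ⁻ i)))))

  -- The gain 2[j < k] of x_i - x_j cancels the x_j⁻¹ part of the loss of
  -- 1 - x_i⁻¹x_j⁻¹.
  D-factor-bound : ∀ {p} → Ordered p → - + (𝟙ₖ (proj₁ p) ℕ.+ 𝟙ₖ (proj₁ p)) ≤[ psum k ] D-factor p
  D-factor-bound {i , j} i<j =
    bound-weaken (ℤₚ.≤-reflexive (trans (neg-pos-+ (𝟙ₖ i) (𝟙ₖ i)) (balance cᵢ cⱼ)))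
                 (bound-⊗ xᵢ-xⱼ 1-xᵢ⁻¹xⱼ⁻¹)
    where
    cᵢ cⱼ : ℤ
    cᵢ = + 𝟙ₖ i
    cⱼ = + 𝟙ₖ j
    cⱼ≤cᵢ : cⱼ ≤ cᵢ
    cⱼ≤cᵢ = ℤ.+≤+ (𝟙-antitone k i<j)
    xᵢ-xⱼ : cⱼ + cⱼ ≤[ psum k ] xi^ i (+ 1) ⊖ xi^ j (+ 1)
    xᵢ-xⱼ = exponents-⊖
      (exponents-Xhalf (subst (cⱼ + cⱼ ≤_) (sym (psum-2eᵢ⁺ i)) (ℤₚ.+-mono-≤ cⱼ≤cᵢ cⱼ≤cᵢ)))
      (exponents-Xhalf (ℤₚ.≤-reflexive (sym (psum-2eᵢ⁺ j))))
    nonpos : - cᵢ + - cⱼ ≤ + 0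
    nonpos = ℤₚ.+-mono-≤ (ℤₚ.neg-≤-pos {𝟙ₖ i} {0}) (ℤₚ.neg-≤-pos {𝟙ₖ j} {0})
    1-xᵢ⁻¹xⱼ⁻¹ : (- cᵢ + - cⱼ) + (- cᵢ + - cⱼ) ≤[ psum k ]
                 one ⊖ X (Vec.zipWith _+_ (unit i (- + 1)) (unit j (- + 1)))
    1-xᵢ⁻¹xⱼ⁻¹ = exponents-⊖
      (bound-weaken (ℤₚ.+-mono-≤ nonpos nonpos) bound-one)
      (exponents-Xhalf (ℤₚ.≤-reflexive (sym (trans (φ-double-+ _ _)
        (cong₂ (λ a b → (a + b) + (a + b)) (psum-unit⁻ k i) (psum-unit⁻ k j))))))
    balance : ∀ cᵢ cⱼ → - cᵢ + - cᵢ ≡ (cⱼ + cⱼ) + ((- cᵢ + - cⱼ) + (- cᵢ + - cⱼ))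
    balance = solve-∀

  A-factor-nonneg : ∀ {p} → Ordered p → + 0 ≤[ psum k ] A-factor p
  A-factor-nonneg {i , j} i<j = exponents-⊖ bound-one (exponents-Xhalf (subst (+ 0 ≤_)
    (sym (trans (φ-double-+ _ _) (cong₂ (λ a b → (a + b) + (a + b)) (psum-unit⁺ k i) (psum-unit⁻ k j))))
    (ℤₚ.+-mono-≤ gap gap)))
    where
    gap : + 0 ≤ + 𝟙ₖ i + - + 𝟙ₖ j
    gap = ℤₚ.i≤j⇒0≤j-i (ℤ.+≤+ (𝟙-antitone k i<j))

  ΔD-deficit : ℕ
  ΔD-deficit = ∑[ i < n ] ((𝟙ₖ i ℕ.+ 𝟙ₖ i) ℕ.* (n ∸ suc (toℕ i)))

  ΔD-bound : - + ΔD-deficit ≤[ psum k ] ΔD n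
  ΔD-bound = subst (λ d → - + d ≤[ psum k ] ΔD n) (sum-map-pairs n (λ i → 𝟙ₖ i ℕ.+ 𝟙ₖ i))
    (bound-prodL D-factor (λ p → 𝟙ₖ (proj₁ p) ℕ.+ 𝟙ₖ (proj₁ p)) (All.map D-factor-bound (pairs-ordered n)))

  singles⊗ΔD-bound : (F : Fin n → Laurent n) (w : Fin n → ℕ) → (∀ i → - + w i ≤[ psum k ] F i) →
                     - + (∑[ i < n ] w i ℕ.+ ΔD-deficit) ≤[ psum k ] prodL (List.map F (indices n)) ⊗ ΔD n
  singles⊗ΔD-bound F w F-bound =
    bound-weaken (ℤₚ.≤-reflexive (neg-pos-+ (∑[ i < n ] w i) ΔD-deficit)) (bound-⊗ singles ΔD-bound)
    where
    singles : - + ∑[ i < n ] w i ≤[ psum k ] prodL (List.map F (indices n))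
    singles = subst (λ d → - + d ≤[ psum k ] prodL (List.map F (indices n))) (sum-map-indices n w)
      (bound-prodL F w (All.universal F-bound (indices n)))

  ΔB-bound : - + (∑[ i < n ] 𝟙ₖ i ℕ.+ ΔD-deficit) ≤[ psum k ] ΔB n
  ΔB-bound = singles⊗ΔD-bound _ 𝟙ₖ B-factor-bound

  ΔC-bound : - + (∑[ i < n ] (𝟙ₖ i ℕ.+ 𝟙ₖ i) ℕ.+ ΔD-deficit) ≤[ psum k ] ΔC n
  ΔC-bound = singles⊗ΔD-bound _ (λ i → 𝟙ₖ i ℕ.+ 𝟙ₖ i) C-factor-bound

  psum-2ρD : psum k (Vec.map (λ a → a + a) (ρD n)) ≡ + ΔD-deficit
  psum-2ρD = begin
    psum k (Vec.map (λ a → a + a) (ρD n))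
      ≡⟨ φ-double (ρD n) ⟩
    psum k (ρD n) + psum k (ρD n)
      ≡⟨ cong₂ _+_ (psum-tabulate k m) (psum-tabulate k m) ⟩
    + (∑[ i < n ] (𝟙ₖ i ℕ.* m i) ℕ.+ ∑[ i < n ] (𝟙ₖ i ℕ.* m i))
      ≡⟨ cong +_ (∑-distrib-+ {n = n} _ _) ⟨
    + ∑[ i < n ] (𝟙ₖ i ℕ.* m i ℕ.+ 𝟙ₖ i ℕ.* m i)
      ≡⟨ cong +_ (sum-cong-≗ {n = n} (λ i → ℕₚ.*-distribʳ-+ (m i) (𝟙ₖ i) (𝟙ₖ i))) ⟨
    + ΔD-deficit ∎
    where
    open ≡-Reasoning
    m : Fin n → ℕ
    m i = n ∸ suc (toℕ i)

  psum-2ρC : psum k (Vec.map (λ a → a + a) (ρC n)) ≡ + (∑[ i < n ] (𝟙ₖ i ℕ.+ 𝟙ₖ i) ℕ.+ ΔD-deficit)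
  psum-2ρC = begin
    psum k (Vec.map (λ a → a + a) (ρC n))
      ≡⟨ φ-double (ρC n) ⟩
    psum k (ρC n) + psum k (ρC n)
      ≡⟨ cong₂ _+_ (psum-tabulate k ρ) (psum-tabulate k ρ) ⟩
    + (∑[ i < n ] (𝟙ₖ i ℕ.* ρ i) ℕ.+ ∑[ i < n ] (𝟙ₖ i ℕ.* ρ i))
      ≡⟨ cong +_ (∑-distrib-+ {n = n} _ _) ⟨
    + ∑[ i < n ] (𝟙ₖ i ℕ.* ρ i ℕ.+ 𝟙ₖ i ℕ.* ρ i)
      ≡⟨ cong +_ (sum-cong-≗ {n = n} (λ i → cong (λ r → 𝟙ₖ i ℕ.* r ℕ.+ 𝟙ₖ i ℕ.* r) (∸-toℕ i))) ⟩
    + ∑[ i < n ] (𝟙ₖ i ℕ.* (1 ℕ.+ m i) ℕ.+ 𝟙ₖ i ℕ.* (1 ℕ.+ m i))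
      ≡⟨ cong +_ (sum-cong-≗ {n = n} (λ i → split (𝟙ₖ i) (m i))) ⟩
    + ∑[ i < n ] ((𝟙ₖ i ℕ.+ 𝟙ₖ i) ℕ.+ (𝟙ₖ i ℕ.+ 𝟙ₖ i) ℕ.* m i)
      ≡⟨ cong +_ (∑-distrib-+ {n = n} _ _) ⟩
    + (∑[ i < n ] (𝟙ₖ i ℕ.+ 𝟙ₖ i) ℕ.+ ΔD-deficit) ∎
    where
    open ≡-Reasoning
    ρ m : Fin n → ℕ
    ρ i = n ∸ toℕ i
    m i = n ∸ suc (toℕ i)
    split : ∀ c m → c ℕ.* (1 ℕ.+ m) ℕ.+ c ℕ.* (1 ℕ.+ m) ≡ (c ℕ.+ c) ℕ.+ (c ℕ.+ c) ℕ.* m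
    split = ℕ-Solver.solve-∀

  psum-2ρB : psum k (Vec.tabulate {n = n} (λ i → + ((n ℕ.+ n) ∸ suc (toℕ i ℕ.+ toℕ i))))
             ≡ + (∑[ i < n ] 𝟙ₖ i ℕ.+ ΔD-deficit)
  psum-2ρB = begin
    psum k (Vec.tabulate {n = n} (λ i → + ((n ℕ.+ n) ∸ suc (toℕ i ℕ.+ toℕ i))))
      ≡⟨ psum-tabulate {n} k _ ⟩
    + ∑[ i < n ] (𝟙ₖ i ℕ.* ((n ℕ.+ n) ∸ suc (toℕ i ℕ.+ toℕ i)))
      ≡⟨ cong +_ (sum-cong-≗ {n = n} (λ i → cong (𝟙ₖ i ℕ.*_) (double-∸-toℕ i))) ⟩
    + ∑[ i < n ] (𝟙ₖ i ℕ.* (1 ℕ.+ (m i ℕ.+ m i)))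
      ≡⟨ cong +_ (sum-cong-≗ {n = n} (λ i → split (𝟙ₖ i) (m i))) ⟩
    + ∑[ i < n ] (𝟙ₖ i ℕ.+ (𝟙ₖ i ℕ.+ 𝟙ₖ i) ℕ.* m i)
      ≡⟨ cong +_ (∑-distrib-+ {n = n} _ _) ⟩
    + (∑[ i < n ] 𝟙ₖ i ℕ.+ ΔD-deficit) ∎
    where
    open ≡-Reasoning
    m : Fin n → ℕ
    m i = n ∸ suc (toℕ i)
    split : ∀ c m → c ℕ.* (1 ℕ.+ (m ℕ.+ m)) ≡ c ℕ.+ (c ℕ.+ c) ℕ.* m
    split = ℕ-Solver.solve-∀

  geomCoeff-nonneg : ∀ j → + 0 ≤[ psum k ] geomCoeff n j
  geomCoeff-nonneg j = Allₚ.map⁺ (exponents-sumL (Allₚ.map⁺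
    (All.universal (λ m → exponents-Xhalf (nonneg m)) (comps n j))))
    where
    nonneg : ∀ (m : Vec ℕ n) → + 0 ≤ psum k (Vec.map (λ a → a + a) (toZ m))
    nonneg m = subst (+ 0 ≤_) (sym (φ-double (toZ m)))
      (ℤₚ.+-mono-≤ (psum-toZ-nonneg k m) (psum-toZ-nonneg k m))

  ρB⊗ΔB-nonneg : + 0 ≤[ psum k ] xρB n ⊗ ΔB n
  ρB⊗ΔB-nonneg = bound-shift (ℤₚ.≤-reflexive (sym psum-2ρB)) ΔB-bound

  ρC⊗ΔC-nonneg : + 0 ≤[ psum k ] X (ρC n) ⊗ ΔC n
  ρC⊗ΔC-nonneg = bound-shift (ℤₚ.≤-reflexive (sym psum-2ρC)) ΔC-bound

  ρD⊗ΔD-nonneg : + 0 ≤[ psum k ] X (ρD n) ⊗ ΔD n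
  ρD⊗ΔD-nonneg = bound-shift (ℤₚ.≤-reflexive (sym psum-2ρD)) ΔD-bound

  ρC⊗ΔC⊗geomCoeff-nonneg : ∀ j → + 0 ≤[ psum k ] X (ρC n) ⊗ ΔC n ⊗ geomCoeff n j
  ρC⊗ΔC⊗geomCoeff-nonneg j = bound-shift (ℤₚ.≤-reflexive (sym psum-2ρC))
    (bound-weaken (ℤₚ.≤-reflexive (sym (ℤₚ.+-identityʳ _))) (bound-⊗ ΔC-bound (geomCoeff-nonneg j)))

  ΠA-nonneg : + 0 ≤[ psum k ] prodL (List.map A-factor (pairs n))
  ΠA-nonneg = nonneg-prodL (Allₚ.map⁺ (All.map A-factor-nonneg (pairs-ordered n)))

module _ {n : ℕ} where
  open LowerBound (λ e → - psum {n} n e) (neg-psum-additive n)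

  A-factor-degree : ∀ p → + 0 ≤[ (λ e → - psum n e) ] A-factor p
  A-factor-degree (i , j) = exponents-⊖ bound-one (exponents-Xhalf (ℤₚ.≤-reflexive (sym
    (trans (φ-double-+ _ _) (cong₂ (λ a b → (- a + - b) + (- a + - b))
      (trans (psum-unit⁺ n i) (cong +_ (𝟙-toℕ< i)))
      (trans (psum-unit⁻ n j) (cong (λ c → - + c) (𝟙-toℕ< j))))))))

  ΠA-degree : + 0 ≤[ (λ e → - psum n e) ] prodL (List.map A-factor (pairs n))
  ΠA-degree = nonneg-prodL (Allₚ.map⁺ (All.universal A-factor-degree (pairs n)))

dominance : ∀ {n} {u v : Vec ℤ n} {R} → (∀ k → + 0 ≤[ psum k ] R) →
            CT (X v ⊗ X u ⊗ R) ≢ + 0 → v ≼ negV u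
dominance {u = u} {v} R≥0 CT≢0 k _ =
  subst (psum k v ≤_) (sym (psum-negV k u)) (LowerBound.pairing-bound (psum k) (psum-additive k) (R≥0 k) CT≢0)

negV-neg-toZ : ∀ {n} (m : Vec ℕ n) → negV (Vec.map (λ a → - + a) m) ≡ toZ m
negV-neg-toZ m = trans (sym (Vecₚ.map-∘ -_ (λ a → - + a) m)) (Vecₚ.map-cong (λ a → ℤₚ.neg-involutive (+ a)) m)

sum-toList : ∀ {n} (m : Vec ℕ n) → Vec.sum m ≡ sum (Vec.toList m)
sum-toList []      = refl
sum-toList (a ∷ m) = cong (a ℕ.+_) (sum-toList m)

sum-reverse : ∀ {n} (m : Vec ℕ n) → Vec.sum (reverse m) ≡ Vec.sum m
sum-reverse m = begin
  Vec.sum (reverse m)                ≡⟨ sum-toList (reverse m) ⟩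
  sum (Vec.toList (reverse m))       ≡⟨ cong sum (Vecₚ.toList-reverse m) ⟩
  sum (List.reverse (Vec.toList m))  ≡⟨ sum-↭ (↭-reverse (Vec.toList m)) ⟩
  sum (Vec.toList m)                 ≡⟨ sum-toList m ⟨
  Vec.sum m                          ∎
  where open ≡-Reasoning

pairAmon≢0⇒degree : ∀ {n} (u v : Vec ℕ n) → pairAmon v u ≢ + 0 → ∣ v ∣ₙ ≡ ∣ u ∣ₙ
pairAmon≢0⇒degree {n} u v CT≢0 = ℤₚ.+-injective (begin
  + Vec.sum v               ≡⟨ psum-toZ-length v ⟨
  psum n (toZ v)            ≡⟨ ℤₚ.≤-antisym upper lower ⟩
  - psum n u⁻               ≡⟨ psum-negV n u⁻ ⟨
  psum n (negV u⁻)          ≡⟨ cong (psum n) (negV-neg-toZ (reverse u)) ⟩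
  psum n (toZ (reverse u))  ≡⟨ psum-toZ-length (reverse u) ⟩
  + Vec.sum (reverse u)     ≡⟨ cong +_ (sum-reverse u) ⟩
  + Vec.sum u               ∎)
  where
  open ≡-Reasoning
  u⁻ : Vec ℤ n
  u⁻ = Vec.map (λ a → - + a) (reverse u)
  upper : psum n (toZ v) ≤ - psum n u⁻
  upper = LowerBound.pairing-bound (psum n) (psum-additive n) (PartialSumBounds.ΠA-nonneg n) CT≢0
  lower : - psum n u⁻ ≤ psum n (toZ v)
  lower = ℤₚ.neg-cancel-≤ (LowerBound.pairing-bound (λ e → - psum n e) (neg-psum-additive n) ΠA-degree CT≢0)

lemma10 : ((♡ : Heart) (n : ℕ) (u v : Vec ℤ n) → PairingNonzero ♡ v u → v ≼ negV u)
    × ((n : ℕ) (u v : Vec ℕ n) → pairAmon v u ≢ + 0 →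
         (toZ v ≼ toZ (reverse u)) × (∣ v ∣ₙ ≡ ∣ u ∣ₙ))
lemma10 = classical , typeA
  where
  open PartialSumBounds
  classical : (♡ : Heart) (n : ℕ) (u v : Vec ℤ n) → PairingNonzero ♡ v u → v ≼ negV u
  classical B  n u v = dominance ρB⊗ΔB-nonneg
  classical C  n u v = dominance ρC⊗ΔC-nonneg
  classical D  n u v = dominance ρD⊗ΔD-nonneg
  -- A nonzero β-coefficient exists only classically; decidability of ≤ and ≟ on ℤ
  -- recovers the conclusion.
  classical BC n u v ≢0 k k≤n = decidable-stable (psum k v ℤₚ.≤? psum k (negV u)) λ v≰-u →
    ≢0 λ j → decidable-stable (pairBC (X v) (X u) j ℤₚ.≟ + 0) λ ≢0ⱼ →
      v≰-u (dominance (λ k → ρC⊗ΔC⊗geomCoeff-nonneg k j) ≢0ⱼ k k≤n)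
  typeA : (n : ℕ) (u v : Vec ℕ n) → pairAmon v u ≢ + 0 → (toZ v ≼ toZ (reverse u)) × (∣ v ∣ₙ ≡ ∣ u ∣ₙ)
  typeA n u v ≢0 = subst (toZ v ≼_) (negV-neg-toZ (reverse u)) (dominance ΠA-nonneg ≢0)
                 , pairAmon≢0⇒degree u v ≢0
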